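{- Let $\theta=\lambda-\mu$ be a skew shape (with $\lambda,\mu$ partitions, $\mu\subseteq\lambda$). Then \[s_{\tau_{0,1}(\theta)}=\varphi\, s_\theta\qquad\text{and}\qquad s_{\tau_{1,0}(\theta)}=\varphi^{ -1}s_\theta.\]
   Context: $R$ is the polynomial ring over $\mathbb{Z}$ in indeterminates $h_{r,s}$ ($r\ge1$, $s\in\mathbb{Z}$); set $h_{0,s}=1$ and $h_{r,s}=0$ for $r<0$. $\varphi$ is the ring automorphism of $R$ with $\varphi(h_{r,s})=h_{r,s+1}$, and $h_r:=h_{r,0}$, so $\varphi^sh_r=h_{r,s}$. For partitions $\lambda,\mu$ and any $n$ with $\ell(\lambda),\ell(\mu)\le n$, $s_{\lambda/\mu}=\det\left(\varphi^{\mu_j-j+1}h_{\lambda_i-\mu_j-i+j}\right)_{1\le i,j\le n}$ (independent of $n$). Young diagrams are sets of cells $(i,j)$ (row $i$, column $j$); a skew shape is a set of cells of the form $\lambda-\mu$ (set difference of Young diagrams, $\mu\subseteq\lambda$), and for a skew shape $\theta$, $s_\theta:=s_{\lambda/\mu}$ for any partitions $\mu\subseteq\lambda$ with $\lambda-\mu=\theta$ (this does not depend on the choice). $\tau_{a,b}$ is the translation of cells $(i,j)\mapsto(i+a,j+b)$; thus $\tau_{0,1}$ shifts a skew shape one column to the right and $\tau_{1,0}$ shifts it one row down (both images are again skew shapes). -}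

module Defs where

open import Data.Nat as ℕ using (ℕ; zero; suc; _⊔_; NonZero)
open import Data.Integer as ℤ using (ℤ; +_; -[1+_])
open import Data.Fin using (Fin; toℕ; punchIn)
import Data.Fin as Fin
open import Data.List using (List; []; _∷_; length)
open import Data.List.Relation.Unary.All using (All)
open import Data.List.Relation.Unary.Linked using (Linked)
open import Data.Product using (Σ; _×_; _,_)
open import Relation.Binary.PropositionalEquality using (_≡_)
open import Function.Bundles using (_⇔_)

-- The ring R = ℤ[h_{r,s} | r ≥ 1, s ∈ ℤ], realised as the free
-- commutative ring on the variables: syntactic expressions modulo the
-- congruence generated by the commutative-ring axioms.
-- The variable  h (suc k) s  is written  var k s  (so r = suc k ≥ 1).

infixl 6 _⊕_
infixl 7 _⊗_
infix 4 _≈_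

data R : Set where
  var : ℕ → ℤ → R
  𝟘 𝟙 : R
  _⊕_ _⊗_ : R → R → R
  ⊖_ : R → R

data _≈_ : R → R → Set where
  ≈-refl  : ∀ {x} → x ≈ x
  ≈-sym   : ∀ {x y} → x ≈ y → y ≈ x
  ≈-trans : ∀ {x y z} → x ≈ y → y ≈ z → x ≈ z
  ⊕-cong  : ∀ {x x' y y'} → x ≈ x' → y ≈ y' → x ⊕ y ≈ x' ⊕ y'
  ⊗-cong  : ∀ {x x' y y'} → x ≈ x' → y ≈ y' → x ⊗ y ≈ x' ⊗ y'
  ⊖-cong  : ∀ {x x'} → x ≈ x' → ⊖ x ≈ ⊖ x'
  ⊕-assoc : ∀ x y z → (x ⊕ y) ⊕ z ≈ x ⊕ (y ⊕ z)
  ⊕-comm  : ∀ x y → x ⊕ y ≈ y ⊕ x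
  ⊕-idˡ   : ∀ x → 𝟘 ⊕ x ≈ x
  ⊖-invˡ  : ∀ x → (⊖ x) ⊕ x ≈ 𝟘
  ⊗-assoc : ∀ x y z → (x ⊗ y) ⊗ z ≈ x ⊗ (y ⊗ z)
  ⊗-comm  : ∀ x y → x ⊗ y ≈ y ⊗ x
  ⊗-idˡ   : ∀ x → 𝟙 ⊗ x ≈ x
  distribʳ : ∀ x y z → (y ⊕ z) ⊗ x ≈ (y ⊗ x) ⊕ (z ⊗ x)

φ^ : ℤ → R → R
φ^ k (var r s) = var r (s ℤ.+ k)
φ^ k 𝟘 = 𝟘
φ^ k 𝟙 = 𝟙
φ^ k (x ⊕ y) = φ^ k x ⊕ φ^ k y
φ^ k (x ⊗ y) = φ^ k x ⊗ φ^ k y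
φ^ k (⊖ x) = ⊖ φ^ k x

φ : R → R
φ = φ^ (+ 1)

φ⁻¹ : R → R
φ⁻¹ = φ^ (-[1+ 0 ])

h : ℤ → R
h -[1+ _ ]   = 𝟘
h (+ zero)   = 𝟙
h (+ suc k)  = var k (+ 0)

sumFin : ∀ {n} → (Fin n → R) → R
sumFin {zero} f = 𝟘
sumFin {suc n} f = f Fin.zero ⊕ sumFin (λ i → f (Fin.suc i))

sign : ℕ → R
sign zero = 𝟙
sign (suc k) = ⊖ sign k

det : ∀ n → (Fin n → Fin n → R) → R
det zero M = 𝟙
det (suc n) M =
  sumFin λ j → sign (toℕ j) ⊗ M Fin.zero j
                ⊗ det n (λ a b → M (Fin.suc a) (punchIn j b))

record Partition : Set where
  constructor mkPartition
  field
    parts    : List ℕ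
    decr     : Linked ℕ._≥_ parts
    positive : All NonZero parts
open Partition public

-- λ_i for i ≥ 1 (λ_i = 0 beyond the length); index 0 is unused (returns 0)
_‼_ : Partition → ℕ → ℕ
p ‼ i = go (parts p) i
  where
  go : List ℕ → ℕ → ℕ
  go [] _ = 0
  go (x ∷ xs) zero = 0
  go (x ∷ xs) (suc zero) = x
  go (x ∷ xs) (suc (suc i)) = go xs (suc i)

ℓ : Partition → ℕ
ℓ p = length (parts p)

_⊆ₚ_ : Partition → Partition → Set
μ ⊆ₚ λ' = ∀ i → μ ‼ i ℕ.≤ λ' ‼ i

-- Skew Schur function s_{λ/μ} = det(φ^{μ_j - j + 1} h_{λ_i - μ_j - i + j})_{1≤i,j≤n}

sDet : ℕ → Partition → Partition → R
sDet n λ' μ = det n entry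
  where
  row col : Fin n → ℤ
  row i = + suc (toℕ i)
  col j = + suc (toℕ j)
  entry : Fin n → Fin n → R
  entry i j = φ^ ((+ (μ ‼ suc (toℕ j)) ℤ.- col j) ℤ.+ + 1)
                 (h (((+ (λ' ‼ suc (toℕ i)) ℤ.- + (μ ‼ suc (toℕ j))) ℤ.- row i) ℤ.+ col j))

-- any n with ℓ(λ), ℓ(μ) ≤ n may be used; we take n = max(ℓ λ, ℓ μ)
s/ : Partition → Partition → R
s/ λ' μ = sDet (ℓ λ' ⊔ ℓ μ) λ' μ

-- Cells (i , j) with i, j ≥ 1 (row i, column j)

Cell : Set
Cell = ℕ × ℕ

_∈ʸ_ : Cell → Partition → Set
(i , j) ∈ʸ p = (1 ℕ.≤ i) × (1 ℕ.≤ j) × (j ℕ.≤ p ‼ i)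

_∈_∖_ : Cell → Partition → Partition → Set
c ∈ λ' ∖ μ = (c ∈ʸ λ') × (c ∈ʸ μ → Data.Empty.⊥)
  where import Data.Empty

τ : ℕ → ℕ → Cell → Cell
τ a b (i , j) = (i ℕ.+ a , j ℕ.+ b)

SkewIsTranslate : ℕ → ℕ → Partition → Partition → Partition → Partition → Set
SkewIsTranslate a b lam' mu' lam mu =
  ∀ (c : Cell) → (c ∈ lam' ∖ mu') ⇔ (Σ Cell λ d → (d ∈ lam ∖ mu) × (τ a b d ≡ c))

{-# OPTIONS --safe #-}

-- Writing x_i = λ_i − i and y_j = μ_j − j (both strictly decreasing), s_{λ/μ} is the
-- determinant of the entries φ^{y_j + 1} h_{x_i − y_j}, and φ^c acts on it by adding c to
-- all x_i and y_j.  A row with x_k = y_k (an empty row of λ − μ) has entry 1 at (k, k),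
-- zeros below it, and zeros to the left of it in all rows ≥ k, so it can be struck out
-- together with its column: the determinant only sees the non-empty rows.  Translating by
-- τ_{a,b} empties the first a rows and moves each non-empty row i, an interval of columns,
-- to row i + a shifted by b, which turns (x_i, y_i) into (x_i + b − a, y_i + b − a).  Hence
-- s_{τ_{a,b}θ} = φ^{b−a} s_θ; the theorem consists of the cases (a, b) = (0, 1) and (1, 0).

module Submission where

open import Defs
open import Algebra.Structures using (IsCommutativeRing)
open import Data.Empty using (⊥-elim)
open import Data.Fin as Fin using (Fin; toℕ; punchIn; inject₁)
import Data.Fin.Properties as Fin
open import Data.Integer as ℤ using (ℤ; +_; -[1+_])
import Data.Integer.Properties as ℤ
open import Data.Integer.Tactic.RingSolver using (solve-∀)
open import Data.List using (List; []; _∷_)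
open import Data.List.Relation.Unary.All as All using (All)
open import Data.List.Relation.Unary.Linked as Linked using (Linked; _∷_)
open import Data.Nat as ℕ using (ℕ; zero; suc; _≤_; _<_; z≤n; s≤s; _⊔_)
import Data.Nat.Properties as ℕ
open import Data.Product using (∃-syntax; _×_; _,_; proj₁; proj₂)
open import Data.Sum using (_⊎_; inj₁; inj₂)
open import Function using (_∘_)
open import Function.Bundles using (Equivalence)
open import Relation.Binary.Bundles using (Setoid)
open import Relation.Binary.Core using (_Preserves_⟶_)
open import Relation.Binary.PropositionalEquality using (_≡_; refl; sym; trans; cong; cong₂; subst)
open import Relation.Binary.Structures using (IsEquivalence)
open import Relation.Nullary using (yes; no)
open import Relation.Nullary.Decidable using (_×-dec_)

private variable
  n m : ℕ

≈-isEquivalence : IsEquivalence _≈_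
≈-isEquivalence = record { refl = ≈-refl ; sym = ≈-sym ; trans = ≈-trans }

≈-setoid : Setoid _ _
≈-setoid = record { isEquivalence = ≈-isEquivalence }

open import Algebra.Consequences.Setoid ≈-setoid
  using (comm∧idˡ⇒id; comm∧invˡ⇒inv; comm∧distrʳ⇒distr)
open import Relation.Binary.Reasoning.Setoid ≈-setoid

R-isCommutativeRing : IsCommutativeRing _≈_ _⊕_ _⊗_ ⊖_ 𝟘 𝟙
R-isCommutativeRing = record
  { isRing = record
    { +-isAbelianGroup = record
      { isGroup = record
        { isMonoid = record
          { isSemigroup = record
            { isMagma = record { isEquivalence = ≈-isEquivalence ; ∙-cong = ⊕-cong }
            ; assoc = ⊕-assoc
            }
          ; identity = comm∧idˡ⇒id ⊕-comm ⊕-idˡ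
          }
        ; inverse = comm∧invˡ⇒inv ⊕-comm ⊖-invˡ
        ; ⁻¹-cong = ⊖-cong
        }
      ; comm = ⊕-comm
      }
    ; *-cong = ⊗-cong
    ; *-assoc = ⊗-assoc
    ; *-identity = comm∧idˡ⇒id ⊗-comm ⊗-idˡ
    ; distrib = comm∧distrʳ⇒distr ⊕-cong ⊗-comm distribʳ
    }
  ; *-comm = ⊗-comm
  }

open IsCommutativeRing R-isCommutativeRing using (+-identityʳ; zeroˡ; zeroʳ)

≡⇒≈ : ∀ {x y} → x ≡ y → x ≈ y
≡⇒≈ = Setoid.reflexive ≈-setoid

φ^-cong : ∀ k {x y} → x ≈ y → φ^ k x ≈ φ^ k y
φ^-cong k ≈-refl             = ≈-refl
φ^-cong k (≈-sym e)          = ≈-sym (φ^-cong k e)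
φ^-cong k (≈-trans e e′)     = ≈-trans (φ^-cong k e) (φ^-cong k e′)
φ^-cong k (⊕-cong e e′)      = ⊕-cong (φ^-cong k e) (φ^-cong k e′)
φ^-cong k (⊗-cong e e′)      = ⊗-cong (φ^-cong k e) (φ^-cong k e′)
φ^-cong k (⊖-cong e)         = ⊖-cong (φ^-cong k e)
φ^-cong k (⊕-assoc x y z)    = ⊕-assoc _ _ _
φ^-cong k (⊕-comm x y)       = ⊕-comm _ _
φ^-cong k (⊕-idˡ x)          = ⊕-idˡ _
φ^-cong k (⊖-invˡ x)         = ⊖-invˡ _
φ^-cong k (⊗-assoc x y z)    = ⊗-assoc _ _ _
φ^-cong k (⊗-comm x y)       = ⊗-comm _ _
φ^-cong k (⊗-idˡ x)          = ⊗-idˡ _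
φ^-cong k (distribʳ x y z)   = distribʳ _ _ _

φ^-φ^ : ∀ k l x → φ^ k (φ^ l x) ≡ φ^ (l ℤ.+ k) x
φ^-φ^ k l (var r s) = cong (var r) (ℤ.+-assoc s l k)
φ^-φ^ k l 𝟘         = refl
φ^-φ^ k l 𝟙         = refl
φ^-φ^ k l (x ⊕ y)   = cong₂ _⊕_ (φ^-φ^ k l x) (φ^-φ^ k l y)
φ^-φ^ k l (x ⊗ y)   = cong₂ _⊗_ (φ^-φ^ k l x) (φ^-φ^ k l y)
φ^-φ^ k l (⊖ x)     = cong ⊖_ (φ^-φ^ k l x)

φ^-sign : ∀ k i → φ^ k (sign i) ≡ sign i
φ^-sign k zero    = refl
φ^-sign k (suc i) = cong ⊖_ (φ^-sign k i)

Matrix : ℕ → Set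
Matrix n = Fin n → Fin n → R

minor : Matrix (suc n) → Fin (suc n) → Fin (suc n) → Matrix n
minor M i j a b = M (punchIn i a) (punchIn j b)

cofactorTerm : Matrix (suc n) → Fin (suc n) → R
cofactorTerm M j = sign (toℕ j) ⊗ M Fin.zero j ⊗ det _ (minor M Fin.zero j)

sumFin-cong : {f g : Fin n → R} → (∀ i → f i ≈ g i) → sumFin f ≈ sumFin g
sumFin-cong {zero}  f≈g = ≈-refl
sumFin-cong {suc n} f≈g = ⊕-cong (f≈g Fin.zero) (sumFin-cong (f≈g ∘ Fin.suc))

sumFin-≈𝟘 : {f : Fin n → R} → (∀ i → f i ≈ 𝟘) → sumFin f ≈ 𝟘
sumFin-≈𝟘 {zero}  f≈𝟘 = ≈-refl
sumFin-≈𝟘 {suc n} f≈𝟘 = ≈-trans (⊕-cong (f≈𝟘 Fin.zero) (sumFin-≈𝟘 (f≈𝟘 ∘ Fin.suc))) (⊕-idˡ 𝟘)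

det-cong : {M N : Matrix n} → (∀ i j → M i j ≈ N i j) → det n M ≈ det n N
det-cong {zero}  M≈N = ≈-refl
det-cong {suc n} {M} {N} M≈N = sumFin-cong {f = cofactorTerm M} {cofactorTerm N} λ j →
  ⊗-cong (⊗-cong ≈-refl (M≈N Fin.zero j)) (det-cong λ a b → M≈N (Fin.suc a) (punchIn j b))

φ^-sumFin : ∀ k (f : Fin n → R) → φ^ k (sumFin f) ≈ sumFin (φ^ k ∘ f)
φ^-sumFin {zero}  k f = ≈-refl
φ^-sumFin {suc n} k f = ⊕-cong ≈-refl (φ^-sumFin k (f ∘ Fin.suc))

φ^-det : ∀ k (M : Matrix n) → φ^ k (det n M) ≈ det n (λ i j → φ^ k (M i j))
φ^-det {zero}  k M = ≈-refl
φ^-det {suc n} k M = ≈-trans (φ^-sumFin k (cofactorTerm M))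
  (sumFin-cong {g = cofactorTerm (λ i j → φ^ k (M i j))} λ j →
  ⊗-cong (⊗-cong (≡⇒≈ (φ^-sign k (toℕ j))) ≈-refl) (φ^-det k (minor M Fin.zero j)))

cofactorTerm-zeroEntry : (M : Matrix (suc n)) (j : Fin (suc n)) →
                         M Fin.zero j ≈ 𝟘 → cofactorTerm M j ≈ 𝟘
cofactorTerm-zeroEntry M j e = begin
  sign (toℕ j) ⊗ M Fin.zero j ⊗ _ ≈⟨ ⊗-cong (⊗-cong ≈-refl e) ≈-refl ⟩
  sign (toℕ j) ⊗ 𝟘 ⊗ _           ≈⟨ ⊗-cong (zeroʳ _) ≈-refl ⟩
  𝟘 ⊗ _                          ≈⟨ zeroˡ _ ⟩
  𝟘                              ∎

cofactorTerm-zeroMinor : (M : Matrix (suc n)) (j : Fin (suc n)) →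
                         det n (minor M Fin.zero j) ≈ 𝟘 → cofactorTerm M j ≈ 𝟘
cofactorTerm-zeroMinor M j e = ≈-trans (⊗-cong ≈-refl e) (zeroʳ _)

toℕ-punchIn-≤ : ∀ (i : Fin (suc n)) j → toℕ (punchIn i j) ≤ suc (toℕ j)
toℕ-punchIn-≤ Fin.zero    j           = ℕ.≤-refl
toℕ-punchIn-≤ (Fin.suc i) Fin.zero    = z≤n
toℕ-punchIn-≤ (Fin.suc i) (Fin.suc j) = s≤s (toℕ-punchIn-≤ i j)

toℕ-punchIn-≥ : ∀ (i : Fin (suc n)) j → toℕ j ≤ toℕ (punchIn i j)
toℕ-punchIn-≥ Fin.zero    j           = ℕ.n≤1+n (toℕ j)
toℕ-punchIn-≥ (Fin.suc i) Fin.zero    = z≤n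
toℕ-punchIn-≥ (Fin.suc i) (Fin.suc j) = s≤s (toℕ-punchIn-≥ i j)

punchIn-below : ∀ (i : Fin (suc n)) j → j Fin.< i → punchIn i j ≡ inject₁ j
punchIn-below (Fin.suc i) Fin.zero    _         = refl
punchIn-below (Fin.suc i) (Fin.suc j) (s≤s j<i) = cong Fin.suc (punchIn-below i j j<i)

toℕ-punchIn-below : ∀ (i : Fin (suc n)) j → j Fin.< i → toℕ (punchIn i j) ≡ toℕ j
toℕ-punchIn-below i j j<i = trans (cong toℕ (punchIn-below i j j<i)) (Fin.toℕ-inject₁ j)

punchIn-above : ∀ (i : Fin (suc n)) j → i Fin.≤ j → punchIn i j ≡ Fin.suc j
punchIn-above Fin.zero    j           _         = refl
punchIn-above (Fin.suc i) (Fin.suc j) (s≤s i≤j) = cong Fin.suc (punchIn-above i j i≤j)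

punchIn-punchIn : ∀ (j k : Fin (suc n)) b → j Fin.≤ k →
                  punchIn (inject₁ j) (punchIn k b) ≡ punchIn (Fin.suc k) (punchIn j b)
punchIn-punchIn Fin.zero    k           b           _         = refl
punchIn-punchIn (Fin.suc j) (Fin.suc k) Fin.zero    _         = refl
punchIn-punchIn (Fin.suc j) (Fin.suc k) (Fin.suc b) (s≤s j≤k) = cong Fin.suc (punchIn-punchIn j k b j≤k)

ZeroBlock : ℕ → ℕ → Matrix n → Set
ZeroBlock p q M = ∀ i j → p ≤ toℕ i → toℕ j < q → M i j ≈ 𝟘

zeroBlock-minor : (M : Matrix (suc n)) (j : Fin (suc n)) {p q : ℕ} →
                  ZeroBlock (suc p) (suc q) M → ZeroBlock p q (minor M Fin.zero j)
zeroBlock-minor M j Z a b p≤a b<q =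
  Z (Fin.suc a) (punchIn j b) (s≤s p≤a) (ℕ.≤-<-trans (toℕ-punchIn-≤ j b) (s≤s b<q))

zeroBlock-minorRight : (M : Matrix (suc n)) (j : Fin (suc n)) {p q : ℕ} → q ≤ toℕ j →
                       ZeroBlock (suc p) q M → ZeroBlock p q (minor M Fin.zero j)
zeroBlock-minorRight M j q≤j Z a b p≤a b<q = Z (Fin.suc a) (punchIn j b) (s≤s p≤a)
  (subst (_< _) (sym (toℕ-punchIn-below j b (ℕ.<-≤-trans b<q q≤j))) b<q)

zeroBlock-minorPivot : (M : Matrix (suc n)) (k : Fin (suc n)) →
                       ZeroBlock (toℕ k) (toℕ k) M → ZeroBlock (toℕ k) (toℕ k) (minor M k k)
zeroBlock-minorPivot M k Z a b k≤a b<k = Z (punchIn k a) (punchIn k b)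
  (ℕ.≤-trans k≤a (toℕ-punchIn-≥ k a)) (subst (_< toℕ k) (sym (toℕ-punchIn-below k b b<k)) b<k)

-- An (n - p) × q block of zeros with p < q meets every transversal of an n × n matrix.
det-zeroBlock : (M : Matrix n) (p q : ℕ) → p < q → q ≤ n → ZeroBlock p q M → det n M ≈ 𝟘
det-zeroBlock {zero}  M p       q       p<q       q≤0       Z = ⊥-elim (ℕ.<⇒≱ (ℕ.<-≤-trans p<q q≤0) z≤n)
det-zeroBlock {suc n} M zero    q       p<q       q≤n       Z = sumFin-≈𝟘 {f = cofactorTerm M} term≈𝟘
  where
  term≈𝟘 : ∀ j → cofactorTerm M j ≈ 𝟘
  term≈𝟘 j with toℕ j ℕ.<? q
  ... | yes j<q = cofactorTerm-zeroEntry M j (Z Fin.zero j z≤n j<q)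
  ... | no  j≮q = cofactorTerm-zeroMinor M j
    (det-zeroBlock (minor M Fin.zero j) zero q p<q (ℕ.≤-trans q≤j (Fin.toℕ≤pred[n] j))
      (zeroBlock-minorRight M j q≤j λ i j _ → Z i j z≤n))
    where q≤j = ℕ.≮⇒≥ j≮q
det-zeroBlock {suc n} M (suc p) (suc q) (s≤s p<q) (s≤s q≤n) Z = sumFin-≈𝟘 {f = cofactorTerm M} λ j →
  cofactorTerm-zeroMinor M j (det-zeroBlock (minor M Fin.zero j) p q p<q q≤n (zeroBlock-minor M j Z))

cofactorTerm-zeroBlock : (M : Matrix (suc n)) {p : ℕ} → ZeroBlock (suc p) (suc p) M →
                         ∀ j → suc p ≤ toℕ j → cofactorTerm M j ≈ 𝟘
cofactorTerm-zeroBlock M Z j p<j = cofactorTerm-zeroMinor M j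
  (det-zeroBlock (minor M Fin.zero j) _ _ ℕ.≤-refl (ℕ.≤-trans p<j (Fin.toℕ≤pred[n] j))
    (zeroBlock-minorRight M j p<j Z))

sumFin-cong-below : ∀ (f : Fin (suc n) → R) (g : Fin n → R) (k : Fin (suc n)) →
                    (∀ j → j Fin.< k → f (inject₁ j) ≈ g j) →
                    (∀ j → k Fin.≤ j → f j ≈ 𝟘) → (∀ j → k Fin.≤ j → g j ≈ 𝟘) →
                    sumFin f ≈ sumFin g
sumFin-cong-below f g Fin.zero _ f≈𝟘 g≈𝟘 =
  ≈-trans (sumFin-≈𝟘 λ j → f≈𝟘 j z≤n) (≈-sym (sumFin-≈𝟘 λ j → g≈𝟘 j z≤n))
sumFin-cong-below {suc n} f g (Fin.suc k) f≈g f≈𝟘 g≈𝟘 =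
  ⊕-cong (f≈g Fin.zero (s≤s z≤n))
    (sumFin-cong-below (f ∘ Fin.suc) (g ∘ Fin.suc) k
      (λ j j<k → f≈g (Fin.suc j) (s≤s j<k)) (λ j k≤j → f≈𝟘 (Fin.suc j) (s≤s k≤j))
      (λ j k≤j → g≈𝟘 (Fin.suc j) (s≤s k≤j)))

-- For k > 0 the terms of the first-row expansion with column j < k match those of the minor
-- (by induction, the pivot moving to k − 1), and those with j ≥ k vanish by det-zeroBlock.
det-unitPivot : (M : Matrix (suc n)) (k : Fin (suc n)) → M k k ≈ 𝟙 →
                ZeroBlock (toℕ k) (toℕ k) M → (∀ i → k Fin.< i → M i k ≈ 𝟘) →
                det (suc n) M ≈ det n (minor M k k)
det-unitPivot {n} M Fin.zero pivot _ below = begin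
  cofactorTerm M Fin.zero ⊕ sumFin (cofactorTerm M ∘ Fin.suc)
    ≈⟨ ⊕-cong leading (sumFin-≈𝟘 λ j → cofactorTerm-zeroMinor M (Fin.suc j) (firstColumnZero j)) ⟩
  det n (minor M Fin.zero Fin.zero) ⊕ 𝟘
    ≈⟨ +-identityʳ _ ⟩
  det n (minor M Fin.zero Fin.zero) ∎
  where
  leading : cofactorTerm M Fin.zero ≈ det n (minor M Fin.zero Fin.zero)
  leading = ≈-trans (⊗-cong (≈-trans (⊗-idˡ _) pivot) ≈-refl) (⊗-idˡ _)
  firstColumnZero : ∀ j → det n (minor M Fin.zero (Fin.suc j)) ≈ 𝟘
  firstColumnZero j = det-zeroBlock _ 0 1 (s≤s z≤n) (ℕ.≤-trans (s≤s z≤n) (Fin.toℕ<n j)) λ where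
    a Fin.zero    _ _         → below (Fin.suc a) (s≤s z≤n)
    a (Fin.suc b) _ (s≤s ())
det-unitPivot {suc n} M (Fin.suc k) pivot Z below =
  sumFin-cong-below (cofactorTerm M) (cofactorTerm (minor M (Fin.suc k) (Fin.suc k))) (Fin.suc k)
    leftTerms (cofactorTerm-zeroBlock M Z) (cofactorTerm-zeroBlock _ (zeroBlock-minorPivot M (Fin.suc k) Z))
  where
  leftTerms : ∀ j → j Fin.< Fin.suc k →
              cofactorTerm M (inject₁ j) ≈ cofactorTerm (minor M (Fin.suc k) (Fin.suc k)) j
  leftTerms j (s≤s j≤k) = ⊗-cong
    (⊗-cong (≡⇒≈ (cong sign (Fin.toℕ-inject₁ j)))
            (≡⇒≈ (cong (M Fin.zero) (sym (punchIn-below (Fin.suc k) j (s≤s j≤k))))))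
    (≈-trans (det-unitPivot N k N-pivot (zeroBlock-minor M (inject₁ j) Z) N-below)
             (det-cong λ a b → ≡⇒≈ (cong (M (Fin.suc (punchIn k a))) (punchIn-punchIn j k b j≤k))))
    where
    N : Matrix (suc n)
    N = minor M Fin.zero (inject₁ j)
    k-column : punchIn (inject₁ j) k ≡ Fin.suc k
    k-column = punchIn-above (inject₁ j) k (subst (_≤ toℕ k) (sym (Fin.toℕ-inject₁ j)) j≤k)
    N-pivot : N k k ≈ 𝟙
    N-pivot = subst (λ c → M (Fin.suc k) c ≈ 𝟙) (sym k-column) pivot
    N-below : ∀ a → k Fin.< a → N a k ≈ 𝟘
    N-below a k<a = subst (λ c → M (Fin.suc a) c ≈ 𝟘) (sym k-column) (below (Fin.suc a) (s≤s k<a))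

skip : ℕ → ℕ → ℕ
skip zero    i       = suc i
skip (suc k) zero    = zero
skip (suc k) (suc i) = suc (skip k i)

toℕ-punchIn : ∀ (k : Fin (suc n)) i → toℕ (punchIn k i) ≡ skip (toℕ k) (toℕ i)
toℕ-punchIn Fin.zero    i           = refl
toℕ-punchIn (Fin.suc k) Fin.zero    = refl
toℕ-punchIn (Fin.suc k) (Fin.suc i) = cong suc (toℕ-punchIn k i)

skip-≤ : ∀ k i → skip k i ≤ suc i
skip-≤ zero    i       = ℕ.≤-refl
skip-≤ (suc k) zero    = z≤n
skip-≤ (suc k) (suc i) = s≤s (skip-≤ k i)

skip-below : ∀ {k i} → i < k → skip k i ≡ i
skip-below {suc k} {zero}  _         = refl
skip-below {suc k} {suc i} (s≤s i<k) = cong suc (skip-below i<k)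

skip-mono-< : ∀ k → skip k Preserves _<_ ⟶ _<_
skip-mono-< zero    i<j                   = s≤s i<j
skip-mono-< (suc k) {zero}  {suc j} _     = s≤s z≤n
skip-mono-< (suc k) {suc i} {suc j} (s≤s i<j) = s≤s (skip-mono-< k i<j)

Decreasing : (ℕ → ℤ) → Set
Decreasing x = x Preserves _<_ ⟶ ℤ._>_

decreasing-≤ : ∀ {x} → Decreasing x → ∀ {i j} → i ≤ j → x j ℤ.≤ x i
decreasing-≤ x↓ i≤j with ℕ.m≤n⇒m<n∨m≡n i≤j
... | inj₁ i<j  = ℤ.<⇒≤ (x↓ i<j)
... | inj₂ refl = ℤ.≤-refl

decreasing-skip : ∀ {x} k → Decreasing x → Decreasing (x ∘ skip k)
decreasing-skip k x↓ i<j = x↓ (skip-mono-< k i<j)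

h-negative : ∀ {a b} → a ℤ.< b → h (a ℤ.- b) ≡ 𝟘
h-negative {a} {b} a<b = h-<0 (subst (a ℤ.- b ℤ.<_) (ℤ.+-inverseʳ b) (ℤ.+-monoˡ-< (ℤ.- b) a<b))
  where
  h-<0 : ∀ {d} → d ℤ.< + 0 → h d ≡ 𝟘
  h-<0 { -[1+ _ ]} _ = refl
  h-<0 {+ _}       (ℤ.+<+ ())

jtEntry : ℤ → ℤ → R
jtEntry a b = φ^ (b ℤ.+ + 1) (h (a ℤ.- b))

jtEntry-< : ∀ {a b} → a ℤ.< b → jtEntry a b ≈ 𝟘
jtEntry-< {b = b} a<b = ≡⇒≈ (cong (φ^ (b ℤ.+ + 1)) (h-negative a<b))

jtEntry-diagonal : ∀ a → jtEntry a a ≈ 𝟙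
jtEntry-diagonal a = ≡⇒≈ (cong (λ d → φ^ (a ℤ.+ + 1) (h d)) (ℤ.+-inverseʳ a))

φ^-jtEntry : ∀ c a b → φ^ c (jtEntry a b) ≡ jtEntry (a ℤ.+ c) (b ℤ.+ c)
φ^-jtEntry c a b = trans (φ^-φ^ c (b ℤ.+ + 1) (h (a ℤ.- b)))
  (cong₂ (λ k d → φ^ k (h d)) (exponent b c) (difference a b c))
  where
  exponent : ∀ b c → (b ℤ.+ + 1) ℤ.+ c ≡ (b ℤ.+ c) ℤ.+ + 1
  exponent = solve-∀
  difference : ∀ a b c → a ℤ.- b ≡ (a ℤ.+ c) ℤ.- (b ℤ.+ c)
  difference = solve-∀

jacobiTrudi : ℕ → (ℕ → ℤ) → (ℕ → ℤ) → R
jacobiTrudi n x y = det n (λ i j → jtEntry (x (toℕ i)) (y (toℕ j)))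

φ^-jacobiTrudi : ∀ c x y → φ^ c (jacobiTrudi n x y) ≈ jacobiTrudi n (λ i → x i ℤ.+ c) (λ i → y i ℤ.+ c)
φ^-jacobiTrudi {n} c x y = ≈-trans (φ^-det {n} c _) (det-cong {n} λ i j →
  ≡⇒≈ (φ^-jtEntry c (x (toℕ i)) (y (toℕ j))))

jacobiTrudi-cong : ∀ {x y x′ y′} → (∀ i → i < n → x i ≡ x′ i) → (∀ i → i < n → y i ≡ y′ i) →
                   jacobiTrudi n x y ≈ jacobiTrudi n x′ y′
jacobiTrudi-cong x≡x′ y≡y′ = det-cong λ i j →
  ≡⇒≈ (cong₂ jtEntry (x≡x′ (toℕ i) (Fin.toℕ<n i)) (y≡y′ (toℕ j) (Fin.toℕ<n j)))

jacobiTrudi-pivot : ∀ {x y} → Decreasing x → Decreasing y → ∀ k → k ≤ n → x k ≡ y k →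
                    jacobiTrudi (suc n) x y ≈ jacobiTrudi n (x ∘ skip k) (y ∘ skip k)
jacobiTrudi-pivot {n} {x} {y} x↓ y↓ k k≤n xₖ≡yₖ
  with kf ← Fin.fromℕ< (s≤s k≤n) | refl ← Fin.toℕ-fromℕ< (s≤s k≤n) = begin
  det (suc n) M          ≈⟨ det-unitPivot M kf pivot zeroBlock below ⟩
  det n (minor M kf kf)  ≈⟨ det-cong {n} (λ a b → ≡⇒≈ (cong₂ (λ i j → jtEntry (x i) (y j))
                                                   (toℕ-punchIn kf a) (toℕ-punchIn kf b))) ⟩
  jacobiTrudi n (x ∘ skip (toℕ kf)) (y ∘ skip (toℕ kf)) ∎
  where
  M : Matrix (suc n)
  M i j = jtEntry (x (toℕ i)) (y (toℕ j))
  pivot : M kf kf ≈ 𝟙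
  pivot = ≈-trans (≡⇒≈ (cong (λ a → jtEntry a _) xₖ≡yₖ)) (jtEntry-diagonal (y (toℕ kf)))
  zeroBlock : ZeroBlock (toℕ kf) (toℕ kf) M
  zeroBlock i j k≤i j<k = jtEntry-<
    (ℤ.≤-<-trans (decreasing-≤ x↓ k≤i) (subst (ℤ._< _) (sym xₖ≡yₖ) (y↓ j<k)))
  below : ∀ i → kf Fin.< i → M i kf ≈ 𝟘
  below i k<i = jtEntry-< (subst (x (toℕ i) ℤ.<_) xₖ≡yₖ (x↓ k<i))

BothEmptyOrEqual : ℤ × ℤ → ℤ × ℤ → Set
BothEmptyOrEqual (a , b) (a′ , b′) = (a ≡ b × a′ ≡ b′) ⊎ (a ≡ a′ × b ≡ b′)

jacobiTrudi-emptyRows : ∀ {x y x′ y′} → Decreasing x → Decreasing y → Decreasing x′ → Decreasing y′ →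
                        (∀ i → i < n → BothEmptyOrEqual (x i , y i) (x′ i , y′ i)) →
                        jacobiTrudi n x y ≈ jacobiTrudi n x′ y′
jacobiTrudi-emptyRows {n} {x} {y} {x′} {y′} x↓ y↓ x′↓ y′↓ rows
  with ℕ.anyUpTo? (λ i → (x i ℤ.≟ y i) ×-dec (x′ i ℤ.≟ y′ i)) n
... | no noneEmpty = jacobiTrudi-cong (λ i i<n → proj₁ (equal i i<n)) (λ i i<n → proj₂ (equal i i<n))
  where
  equal : ∀ i → i < n → x i ≡ x′ i × y i ≡ y′ i
  equal i i<n with rows i i<n
  ... | inj₁ empty = ⊥-elim (noneEmpty (i , i<n , empty))
  ... | inj₂ eq    = eq
jacobiTrudi-emptyRows {suc n} {x} {y} {x′} {y′} x↓ y↓ x′↓ y′↓ rows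
  | yes (k , s≤s k≤n , xₖ≡yₖ , x′ₖ≡y′ₖ) = begin
  jacobiTrudi (suc n) x y                ≈⟨ jacobiTrudi-pivot x↓ y↓ k k≤n xₖ≡yₖ ⟩
  jacobiTrudi n (x ∘ skip k) (y ∘ skip k) ≈⟨ jacobiTrudi-emptyRows
      (decreasing-skip k x↓) (decreasing-skip k y↓) (decreasing-skip k x′↓) (decreasing-skip k y′↓)
      (λ i i<n → rows (skip k i) (s≤s (ℕ.≤-trans (skip-≤ k i) i<n))) ⟩
  jacobiTrudi n (x′ ∘ skip k) (y′ ∘ skip k) ≈⟨ jacobiTrudi-pivot x′↓ y′↓ k k≤n x′ₖ≡y′ₖ ⟨
  jacobiTrudi (suc n) x′ y′              ∎

jacobiTrudi-pad : ∀ {x y} → Decreasing x → Decreasing y → n ≤ m → (∀ i → n ≤ i → x i ≡ y i) →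
                  jacobiTrudi m x y ≈ jacobiTrudi n x y
jacobiTrudi-pad {m = zero}  x↓ y↓ z≤n     _    = ≈-refl
jacobiTrudi-pad {n} {suc m} {x} {y} x↓ y↓ n≤1+m tail with ℕ.m≤n⇒m<n∨m≡n n≤1+m
... | inj₂ refl      = ≈-refl
... | inj₁ (s≤s n≤m) = begin
  jacobiTrudi (suc m) x y                 ≈⟨ jacobiTrudi-pivot x↓ y↓ m ℕ.≤-refl (tail m n≤m) ⟩
  jacobiTrudi m (x ∘ skip m) (y ∘ skip m) ≈⟨ jacobiTrudi-cong {m} (λ i i<m → cong x (skip-below i<m))
                                                                   (λ i i<m → cong y (skip-below i<m)) ⟩
  jacobiTrudi m x y                       ≈⟨ jacobiTrudi-pad x↓ y↓ n≤m tail ⟩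
  jacobiTrudi n x y                       ∎

jacobiTrudi-dropLeading : ∀ a {x y} → Decreasing x → Decreasing y → (∀ i → i < a → x i ≡ y i) →
                          jacobiTrudi (a ℕ.+ n) x y ≈ jacobiTrudi n (λ i → x (a ℕ.+ i)) (λ i → y (a ℕ.+ i))
jacobiTrudi-dropLeading zero    x↓ y↓ leading = ≈-refl
jacobiTrudi-dropLeading (suc a) x↓ y↓ leading =
  ≈-trans (jacobiTrudi-pivot x↓ y↓ 0 z≤n (leading 0 (s≤s z≤n)))
          (jacobiTrudi-dropLeading a (decreasing-skip 0 x↓) (decreasing-skip 0 y↓)
                                     (λ i i<a → leading (suc i) (s≤s i<a)))

dropFirstRow : (x : ℕ) (xs : List ℕ) → Linked ℕ._≥_ (x ∷ xs) → All ℕ.NonZero (x ∷ xs) → Partition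
dropFirstRow x xs decr positive = mkPartition xs (Linked.tail decr) (All.tail positive)

‼-step : ∀ (p : Partition) i → p ‼ suc (suc i) ≤ p ‼ suc i
‼-step (mkPartition []          _          _)   i       = z≤n
‼-step (mkPartition (x ∷ [])    _          _)   i       = z≤n
‼-step (mkPartition (x ∷ y ∷ _) (x≥y ∷ _)  _)   zero    = x≥y
‼-step (mkPartition (x ∷ xs@(_ ∷ _)) decr pos) (suc i) = ‼-step (dropFirstRow x xs decr pos) i

‼-antitone : ∀ (p : Partition) {i j} → i ≤ j → p ‼ suc j ≤ p ‼ suc i
‼-antitone p {j = zero}  z≤n     = ℕ.≤-refl
‼-antitone p {j = suc j} i≤1+j with ℕ.m≤n⇒m<n∨m≡n i≤1+j
... | inj₂ refl      = ℕ.≤-refl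
... | inj₁ (s≤s i≤j) = ℕ.≤-trans (‼-step p j) (‼-antitone p i≤j)

‼-beyondLength : ∀ (p : Partition) {i} → ℓ p ≤ i → p ‼ suc i ≡ 0
‼-beyondLength (mkPartition []       _    _)   _         = refl
‼-beyondLength (mkPartition (x ∷ xs) decr pos) (s≤s ℓ≤i) = ‼-beyondLength (dropFirstRow x xs decr pos) ℓ≤i

-- The 0-based index i stands for row i + 1: this is the content λ_{i+1} − (i + 1) of its last cell.
lastContent : Partition → ℕ → ℤ
lastContent p i = + (p ‼ suc i) ℤ.- + suc i

lastContent-decreasing : ∀ p → Decreasing (lastContent p)
lastContent-decreasing p i<j =
  ℤ.+-mono-≤-< (ℤ.+≤+ (‼-antitone p (ℕ.<⇒≤ i<j))) (ℤ.neg-mono-< (ℤ.+<+ (s≤s i<j)))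

sDet≈jacobiTrudi : ∀ n λ′ μ → sDet n λ′ μ ≈ jacobiTrudi n (lastContent λ′) (lastContent μ)
sDet≈jacobiTrudi n λ′ μ = det-cong {n} λ i j →
  ≡⇒≈ (cong (φ^ (lastContent μ (toℕ j) ℤ.+ + 1) ∘ h)
            (regroup (+ (λ′ ‼ suc (toℕ i))) (+ (μ ‼ suc (toℕ j))) (+ suc (toℕ i)) (+ suc (toℕ j))))
  where
  regroup : ∀ a b i j → ((a ℤ.- b) ℤ.- i) ℤ.+ j ≡ (a ℤ.- i) ℤ.- (b ℤ.- j)
  regroup = solve-∀

s/≈jacobiTrudi : ∀ λ′ μ {N} → ℓ λ′ ⊔ ℓ μ ≤ N → s/ λ′ μ ≈ jacobiTrudi N (lastContent λ′) (lastContent μ)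
s/≈jacobiTrudi λ′ μ ℓ≤N = ≈-trans (sDet≈jacobiTrudi (ℓ λ′ ⊔ ℓ μ) λ′ μ) (≈-sym
  (jacobiTrudi-pad (lastContent-decreasing λ′) (lastContent-decreasing μ) ℓ≤N λ i ℓ≤i →
    cong (λ r → + r ℤ.- + suc i)
      (trans (‼-beyondLength λ′ (ℕ.≤-trans (ℕ.m≤m⊔n _ _) ℓ≤i))
             (sym (‼-beyondLength μ (ℕ.≤-trans (ℕ.m≤n⊔m _ _) ℓ≤i))))))

-- Rows with λ_r = l and μ_r = m occupy the columns m < j ≤ l; a translation by b matches them up.
interval-translate : ∀ {m₀ l₀ m₁ l₁} b → m₀ ≤ l₀ → m₁ ≤ l₁ →
                     (∀ j → m₀ < j → j ≤ l₀ → m₁ < j ℕ.+ b × j ℕ.+ b ≤ l₁) →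
                     (∀ j → m₁ < j → j ≤ l₁ → ∃[ d ] d ℕ.+ b ≡ j × m₀ < d × d ≤ l₀) →
                     (l₀ ≡ m₀ × l₁ ≡ m₁) ⊎ (l₁ ≡ l₀ ℕ.+ b × m₁ ≡ m₀ ℕ.+ b)
interval-translate b m₀≤l₀ m₁≤l₁ into onto with ℕ.m≤n⇒m<n∨m≡n m₀≤l₀ | ℕ.m≤n⇒m<n∨m≡n m₁≤l₁
... | inj₂ refl | inj₂ refl = inj₁ (refl , refl)
... | inj₂ refl | inj₁ m₁<l₁ with onto _ m₁<l₁ ℕ.≤-refl
...   | _ , _ , m₀<d , d≤m₀ = ⊥-elim (ℕ.<⇒≱ m₀<d d≤m₀)
interval-translate {m₀} {l₀} {m₁} {l₁} b _ _ into onto | inj₁ m₀<l₀ | _ =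
  inj₂ (ℕ.≤-antisym l₁≤l₀+b l₀+b≤l₁ , ℕ.≤-antisym m₁≤m₀+b m₀+b≤m₁)
  where
  l₀+b≤l₁ : l₀ ℕ.+ b ≤ l₁
  l₀+b≤l₁ = proj₂ (into l₀ m₀<l₀ ℕ.≤-refl)
  m₁<l₁ : m₁ < l₁
  m₁<l₁ = ℕ.<-≤-trans (proj₁ (into l₀ m₀<l₀ ℕ.≤-refl)) l₀+b≤l₁
  m₁≤m₀+b : m₁ ≤ m₀ ℕ.+ b
  m₁≤m₀+b = ℕ.≤-pred (proj₁ (into (suc m₀) ℕ.≤-refl m₀<l₀))
  l₁≤l₀+b : l₁ ≤ l₀ ℕ.+ b
  l₁≤l₀+b with onto l₁ m₁<l₁ ℕ.≤-refl
  ... | d , d+b≡l₁ , _ , d≤l₀ = subst (_≤ l₀ ℕ.+ b) d+b≡l₁ (ℕ.+-monoˡ-≤ b d≤l₀)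
  m₀+b≤m₁ : m₀ ℕ.+ b ≤ m₁
  m₀+b≤m₁ with onto (suc m₁) ℕ.≤-refl m₁<l₁
  ... | d , d+b≡1+m₁ , m₀<d , _ = ℕ.≤-pred (subst (suc m₀ ℕ.+ b ≤_) d+b≡1+m₁ (ℕ.+-monoˡ-≤ b m₀<d))

∈∖-intro : ∀ λ′ μ {r j} → 1 ≤ r → μ ‼ r < j → j ≤ λ′ ‼ r → (r , j) ∈ λ′ ∖ μ
∈∖-intro _ _ 1≤r μ<j j≤λ = (1≤r , ℕ.≤-trans (s≤s z≤n) μ<j , j≤λ) , λ (_ , _ , j≤μ) → ℕ.<⇒≱ μ<j j≤μ

∈∖-elim : ∀ λ′ μ {r j} → (r , j) ∈ λ′ ∖ μ → μ ‼ r < j × j ≤ λ′ ‼ r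
∈∖-elim _ _ ((1≤r , 1≤j , j≤λ) , ∉μ) = ℕ.≰⇒> (λ j≤μ → ∉μ (1≤r , 1≤j , j≤μ)) , j≤λ

module Translation {a b : ℕ} {λ₀ μ₀ λ₁ μ₁ : Partition} (T : SkewIsTranslate a b λ₁ μ₁ λ₀ μ₀) where

  translate-row : μ₀ ⊆ₚ λ₀ → μ₁ ⊆ₚ λ₁ → ∀ r → 1 ≤ r →
                  (λ₀ ‼ r ≡ μ₀ ‼ r × λ₁ ‼ (r ℕ.+ a) ≡ μ₁ ‼ (r ℕ.+ a)) ⊎
                  (λ₁ ‼ (r ℕ.+ a) ≡ λ₀ ‼ r ℕ.+ b × μ₁ ‼ (r ℕ.+ a) ≡ μ₀ ‼ r ℕ.+ b)
  translate-row sub₀ sub₁ r 1≤r = interval-translate b (sub₀ r) (sub₁ (r ℕ.+ a)) into onto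
    where
    into : ∀ j → μ₀ ‼ r < j → j ≤ λ₀ ‼ r → μ₁ ‼ (r ℕ.+ a) < j ℕ.+ b × j ℕ.+ b ≤ λ₁ ‼ (r ℕ.+ a)
    into j μ<j j≤λ = ∈∖-elim λ₁ μ₁
      (Equivalence.from (T (r ℕ.+ a , j ℕ.+ b)) ((r , j) , ∈∖-intro λ₀ μ₀ 1≤r μ<j j≤λ , refl))
    onto : ∀ j → μ₁ ‼ (r ℕ.+ a) < j → j ≤ λ₁ ‼ (r ℕ.+ a) → ∃[ d ] d ℕ.+ b ≡ j × μ₀ ‼ r < d × d ≤ λ₀ ‼ r
    onto j μ<j j≤λ
      with Equivalence.to (T (r ℕ.+ a , j)) (∈∖-intro λ₁ μ₁ (ℕ.≤-trans 1≤r (ℕ.m≤m+n r a)) μ<j j≤λ)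
    ... | (r′ , d) , d∈θ₀ , τd≡rj with ℕ.+-cancelʳ-≡ a r′ r (cong proj₁ τd≡rj)
    ...   | refl = d , cong proj₂ τd≡rj , ∈∖-elim λ₀ μ₀ d∈θ₀

  translate-leadingRowEmpty : μ₁ ⊆ₚ λ₁ → ∀ r → 1 ≤ r → r ≤ a → λ₁ ‼ r ≡ μ₁ ‼ r
  translate-leadingRowEmpty sub₁ r 1≤r r≤a with ℕ.m≤n⇒m<n∨m≡n (sub₁ r)
  ... | inj₂ μ≡λ = sym μ≡λ
  ... | inj₁ μ<λ with Equivalence.to (T (r , λ₁ ‼ r)) (∈∖-intro λ₁ μ₁ 1≤r μ<λ ℕ.≤-refl)
  ...   | (r′ , _) , ((1≤r′ , _) , _) , τd≡rj =
    ⊥-elim (ℕ.<⇒≱ (ℕ.+-monoˡ-≤ a 1≤r′) (subst (_≤ a) (sym (cong proj₁ τd≡rj)) r≤a))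

  translate-lastContent : μ₀ ⊆ₚ λ₀ → μ₁ ⊆ₚ λ₁ → ∀ i →
    BothEmptyOrEqual (lastContent λ₁ (a ℕ.+ i) , lastContent μ₁ (a ℕ.+ i))
                     (lastContent λ₀ i ℤ.+ (+ b ℤ.- + a) , lastContent μ₀ i ℤ.+ (+ b ℤ.- + a))
  translate-lastContent sub₀ sub₁ i rewrite ℕ.+-comm a i with translate-row sub₀ sub₁ (suc i) (s≤s z≤n)
  ... | inj₁ (λ₀≡μ₀ , λ₁≡μ₁) =
    inj₁ (cong (λ l → + l ℤ.- + suc (i ℕ.+ a)) λ₁≡μ₁ ,
          cong (λ l → (+ l ℤ.- + suc i) ℤ.+ (+ b ℤ.- + a)) λ₀≡μ₀)
  ... | inj₂ (λ₁≡λ₀+b , μ₁≡μ₀+b) =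
    inj₂ (trans (cong (λ l → + l ℤ.- + suc (i ℕ.+ a)) λ₁≡λ₀+b) (shifted (λ₀ ‼ suc i)) ,
          trans (cong (λ l → + l ℤ.- + suc (i ℕ.+ a)) μ₁≡μ₀+b) (shifted (μ₀ ‼ suc i)))
    where
    shifted : ∀ l → + (l ℕ.+ b) ℤ.- + suc (i ℕ.+ a) ≡ (+ l ℤ.- + suc i) ℤ.+ (+ b ℤ.- + a)
    shifted l = trans (cong₂ ℤ._-_ (ℤ.pos-+ l b) (ℤ.pos-+ (suc i) a)) (regroup (+ l) (+ b) (+ suc i) (+ a))
      where
      regroup : ∀ l b s a → (l ℤ.+ b) ℤ.- (s ℤ.+ a) ≡ (l ℤ.- s) ℤ.+ (b ℤ.- a)
      regroup = solve-∀

  translate-leadingContent : μ₁ ⊆ₚ λ₁ → ∀ i → i < a → lastContent λ₁ i ≡ lastContent μ₁ i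
  translate-leadingContent sub₁ i i<a =
    cong (λ l → + l ℤ.- + suc i) (translate-leadingRowEmpty sub₁ (suc i) (s≤s z≤n) i<a)

s/-translate : ∀ {a b} (λ₀ μ₀ λ₁ μ₁ : Partition) → μ₀ ⊆ₚ λ₀ → μ₁ ⊆ₚ λ₁ → SkewIsTranslate a b λ₁ μ₁ λ₀ μ₀ →
               s/ λ₁ μ₁ ≈ φ^ (+ b ℤ.- + a) (s/ λ₀ μ₀)
s/-translate {a} {b} λ₀ μ₀ λ₁ μ₁ sub₀ sub₁ T = begin
  s/ λ₁ μ₁
    ≈⟨ s/≈jacobiTrudi λ₁ μ₁ (ℕ.≤-trans (ℕ.m≤n⊔m (ℓ λ₀ ⊔ ℓ μ₀) _) (ℕ.m≤n+m N a)) ⟩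
  jacobiTrudi (a ℕ.+ N) (lastContent λ₁) (lastContent μ₁)
    ≈⟨ jacobiTrudi-dropLeading {n = N} a (lastContent-decreasing λ₁) (lastContent-decreasing μ₁)
                                 (translate-leadingContent sub₁) ⟩
  jacobiTrudi N (λ i → lastContent λ₁ (a ℕ.+ i)) (λ i → lastContent μ₁ (a ℕ.+ i))
    ≈⟨ jacobiTrudi-emptyRows {n = N} (dropped λ₁) (dropped μ₁) (shifted λ₀) (shifted μ₀)
                             (λ i _ → translate-lastContent sub₀ sub₁ i) ⟩
  jacobiTrudi N (λ i → lastContent λ₀ i ℤ.+ c) (λ i → lastContent μ₀ i ℤ.+ c)
    ≈⟨ φ^-jacobiTrudi {n = N} c (lastContent λ₀) (lastContent μ₀) ⟨
  φ^ c (jacobiTrudi N (lastContent λ₀) (lastContent μ₀))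
    ≈⟨ φ^-cong c (s/≈jacobiTrudi λ₀ μ₀ (ℕ.m≤m⊔n _ (ℓ λ₁ ⊔ ℓ μ₁))) ⟨
  φ^ c (s/ λ₀ μ₀) ∎
  where
  open Translation {a} {b} {λ₀} {μ₀} {λ₁} {μ₁} T
  N : ℕ
  N = (ℓ λ₀ ⊔ ℓ μ₀) ⊔ (ℓ λ₁ ⊔ ℓ μ₁)
  c : ℤ
  c = + b ℤ.- + a
  dropped : ∀ p → Decreasing (λ i → lastContent p (a ℕ.+ i))
  dropped p i<j = lastContent-decreasing p (ℕ.+-monoʳ-< a i<j)
  shifted : ∀ p → Decreasing (λ i → lastContent p i ℤ.+ c)
  shifted p i<j = ℤ.+-monoˡ-< c (lastContent-decreasing p i<j)

mainTheorem16 : (λ₀ μ₀ : Partition) → μ₀ ⊆ₚ λ₀ →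
    (∀ (λ₁ μ₁ : Partition) → μ₁ ⊆ₚ λ₁ →
        SkewIsTranslate 0 1 λ₁ μ₁ λ₀ μ₀ → s/ λ₁ μ₁ ≈ φ (s/ λ₀ μ₀))
  × (∀ (λ₁ μ₁ : Partition) → μ₁ ⊆ₚ λ₁ →
        SkewIsTranslate 1 0 λ₁ μ₁ λ₀ μ₀ → s/ λ₁ μ₁ ≈ φ⁻¹ (s/ λ₀ μ₀))
mainTheorem16 λ₀ μ₀ sub₀ =
  (λ λ₁ μ₁ → s/-translate λ₀ μ₀ λ₁ μ₁ sub₀) , (λ λ₁ μ₁ → s/-translate λ₀ μ₀ λ₁ μ₁ sub₀)
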